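{- Let $F$ be an infinite family of finite subsets of $\mathbb{N}$ which is an antichain with respect to $\subseteq$. Then there exist pairwise distinct sets $A_i\in F$ ($i<\omega$) and natural numbers $k_i$ ($i<\omega$) such that $k_i\in A_i\setminus\bigcup_{j\neq i}A_j$ for every $i<\omega$. -}

module Defs where

open import Data.Nat using (ℕ)
open import Data.List using (List)
open import Data.Product using (_×_)
open import Relation.Nullary using (¬_)
open import Relation.Binary.PropositionalEquality using (_≢_)
open import Data.List.Membership.Propositional using (_∈_)

-- A finite subset of ℕ is represented by a list of its elements
-- (order and repetitions irrelevant: all notions below go through membership).
FinSubset : Set
FinSubset = List ℕ

_⊆ˢ_ : FinSubset → FinSubset → Set
X ⊆ˢ Y = ∀ {x} → x ∈ X → x ∈ Y

_≐_ : FinSubset → FinSubset → Set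
X ≐ Y = (X ⊆ˢ Y) × (Y ⊆ˢ X)

-- An infinite family of finite subsets of ℕ, given by an enumeration
-- A : ℕ → FinSubset, is an antichain w.r.t. ⊆ when distinct indices give
-- ⊆-incomparable sets (this forces the A n to be pairwise distinct, so the
-- family {A n | n ∈ ℕ} is infinite).
IsAntichain : (ℕ → FinSubset) → Set
IsAntichain A = ∀ m n → m ≢ n → ¬ (A m ⊆ˢ A n)

-- Choose the sets one at a time, keeping an infinite pool of candidate indices.
-- Before each choice, thin the pool (infinite pigeonhole, once per element used
-- so far) until membership of every used element is constant on it.  Any
-- candidate A c then has an element x outside the used sets that is missing from
-- infinitely many later candidates: otherwise A c ⊆ A m for all large candidates
-- m, against the antichain property.  Record x as the private element of A c and
-- keep only the candidates above c that miss x.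
module Submission where

open import Defs
open import Level using (0ℓ)
open import Axiom.ExcludedMiddle using (ExcludedMiddle)
open import Axiom.DoubleNegationElimination using (em⇒dne)
open import Data.Nat using (ℕ; zero; suc; _≤_; _<_; _≤′_; ≤′-refl; ≤′-step; _⊔_; _≟_)
open import Data.Nat.Properties using (≤-refl; ≤-trans; m≤m⊔n; m≤n⊔m; ≤⇒≤′; <-cmp; <-irrefl)
open import Data.Product using (_×_; ∃-syntax; Σ-syntax; _,_; proj₁; proj₂)
open import Data.Sum using (_⊎_; inj₁; inj₂)
open import Data.Unit using (⊤; tt)
open import Data.Empty using (⊥-elim)
open import Data.List using (List; []; _∷_; _++_)
open import Data.List.Relation.Unary.All as All using (All; []; _∷_)
open import Data.List.Relation.Unary.Any using (here; there)
open import Data.List.Membership.Propositional using (_∈_; _∉_)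
open import Data.List.Membership.Propositional.Properties using (∈-++⁺ˡ; ∈-++⁺ʳ)
open import Data.List.Membership.DecPropositional _≟_ using (_∈?_)
open import Function using (id; _∘_)
open import Relation.Nullary using (¬_; yes; no)
open import Relation.Nullary.Decidable using (decidable-stable)
open import Relation.Binary using (tri<; tri≈; tri>)
open import Relation.Binary.PropositionalEquality using (_≢_; refl; sym)
open import Relation.Unary using (Pred; _⊆_; _∩_)

Infinite : Pred ℕ 0ℓ → Set
Infinite P = ∀ n → ∃[ m ] n ≤ m × P m

Eventually : Pred ℕ 0ℓ → Set
Eventually P = ∃[ N ] ∀ m → N ≤ m → P m

infinite-map : {P Q : Pred ℕ 0ℓ} → P ⊆ Q → Infinite P → Infinite Q
infinite-map P⊆Q inf n with inf n
... | m , n≤m , Pm = m , n≤m , P⊆Q Pm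

infinite-∩-eventually : {P Q : Pred ℕ 0ℓ} → Infinite P → Eventually Q → Infinite (P ∩ Q)
infinite-∩-eventually inf (N , ev) n with inf (n ⊔ N)
... | m , n⊔N≤m , Pm =
  m , ≤-trans (m≤m⊔n n N) n⊔N≤m , Pm , ev m (≤-trans (m≤n⊔m n N) n⊔N≤m)

eventually-above : ∀ c → Eventually (c <_)
eventually-above c = suc c , λ _ c<m → c<m

eventually-all : {X : Set} {S : X → Pred ℕ 0ℓ} {xs : List X} →
                 All (Eventually ∘ S) xs → Eventually (λ m → All (λ x → S x m) xs)
eventually-all [] = 0 , λ _ _ → []
eventually-all ((N , evx) ∷ evs) with eventually-all evs
... | M , evxs = N ⊔ M , λ m N⊔M≤m →
  evx m (≤-trans (m≤m⊔n N M) N⊔M≤m) ∷ evxs m (≤-trans (m≤n⊔m N M) N⊔M≤m)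

Homogeneous : {X : Set} → (X → Pred ℕ 0ℓ) → List X → Pred ℕ 0ℓ → Set
Homogeneous R U Q = ∀ {u} → u ∈ U → ∀ {m m′} → Q m → Q m′ → R u m → R u m′

homogeneous-∷ : {X : Set} {R : X → Pred ℕ 0ℓ} {u : X} {U : List X} {Q Q′ : Pred ℕ 0ℓ} →
  Homogeneous R U Q → Q′ ⊆ Q → (∀ {m m′} → Q′ m → Q′ m′ → R u m → R u m′) →
  Homogeneous R (u ∷ U) Q′
homogeneous-∷ _ _ homu (here refl) = homu
homogeneous-∷ homQ Q′⊆Q _ (there u∈U) Q′m Q′m′ = homQ u∈U (Q′⊆Q Q′m) (Q′⊆Q Q′m′)

module Classical (em : ExcludedMiddle 0ℓ) where

  infinite⊎eventually-not : (P : Pred ℕ 0ℓ) → Infinite P ⊎ Eventually (¬_ ∘ P)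
  infinite⊎eventually-not P with em {Infinite P}
  ... | yes inf = inj₁ inf
  ... | no ¬inf = inj₂ (em⇒dne em λ ¬ev →
    ¬inf λ n → em⇒dne em λ ¬Pabove → ¬ev (n , λ m n≤m Pm → ¬Pabove (m , n≤m , Pm)))

  infinite-split : {P : Pred ℕ 0ℓ} (B : Pred ℕ 0ℓ) → Infinite P →
                   Infinite (P ∩ B) ⊎ Infinite (P ∩ (¬_ ∘ B))
  infinite-split {P} B inf with infinite⊎eventually-not (P ∩ B)
  ... | inj₁ infB = inj₁ infB
  ... | inj₂ ev = inj₂ (infinite-map (λ (Pm , ¬PBm) → Pm , λ Bm → ¬PBm (Pm , Bm))
                                     (infinite-∩-eventually inf ev))

  infinite-homogeneous-subset : {X : Set} (R : X → Pred ℕ 0ℓ) (U : List X) {P : Pred ℕ 0ℓ} →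
    Infinite P → ∃[ Q ] Infinite Q × Q ⊆ P × Homogeneous R U Q
  infinite-homogeneous-subset R [] inf = _ , inf , id , λ ()
  infinite-homogeneous-subset R (u ∷ U) inf with infinite-homogeneous-subset R U inf
  ... | Q , infQ , Q⊆P , homQ with infinite-split (R u) infQ
  ... | inj₁ infR = Q ∩ R u , infR , Q⊆P ∘ proj₁ ,
                     homogeneous-∷ homQ proj₁ λ _ (_ , Rum′) _ → Rum′
  ... | inj₂ inf¬R = Q ∩ (¬_ ∘ R u) , inf¬R , Q⊆P ∘ proj₁ ,
                     homogeneous-∷ homQ proj₁ λ (_ , ¬Rum) _ Rum → ⊥-elim (¬Rum Rum)

module Construction (em : ExcludedMiddle 0ℓ) (A : ℕ → FinSubset) (anti : IsAntichain A) where

  open Classical em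

  _∈A_ : ℕ → Pred ℕ 0ℓ
  x ∈A m = x ∈ A m

  private-element : {Q : Pred ℕ 0ℓ} {U : List ℕ} → Infinite Q → Homogeneous _∈A_ U Q →
    ∀ {c} → Q c → ∃[ x ] x ∈ A c × x ∉ U × Infinite (Q ∩ λ m → x ∉ A m)
  private-element {Q} {U} inf hom {c} Qc = em⇒dne em λ none →
    let m , _ , (Qm , covered) , c<m = infinite-∩-eventually
          (infinite-∩-eventually inf (eventually-all (All.tabulate (persists none))))
          (eventually-above c) 0
    in anti c m (λ c≡m → <-irrefl c≡m c<m) λ x∈Ac → All.lookup covered x∈Ac Qm
    where
    persists : ¬ (∃[ x ] x ∈ A c × x ∉ U × Infinite (Q ∩ λ m → x ∉ A m)) →
               ∀ {x} → x ∈ A c → Eventually (λ m → Q m → x ∈ A m)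
    persists none {x} x∈Ac with x ∈? U
    ... | yes x∈U = 0 , λ _ _ Qm → hom x∈U Qc Qm x∈Ac
    ... | no x∉U with infinite⊎eventually-not (Q ∩ λ m → x ∉ A m)
    ... | inj₁ infx = ⊥-elim (none (x , x∈Ac , x∉U , infx))
    ... | inj₂ (N , ev) = N , λ m N≤m Qm →
      decidable-stable (x ∈? A m) λ x∉Am → ev m N≤m (Qm , x∉Am)

  record Stage : Set₁ where
    field
      candidates : Pred ℕ 0ℓ
      infinite : Infinite candidates
      used : List ℕ

  record Choice (s : Stage) : Set₁ where
    open Stage s
    field
      index : ℕ
      witness : ℕ
      remaining : Pred ℕ 0ℓ
      remaining-infinite : Infinite remaining
      remaining⊆candidates : remaining ⊆ candidates
      index∈candidates : candidates index
      witness∈index : witness ∈ A index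
      witness∉used : witness ∉ used
      witness∉remaining : ∀ {m} → remaining m → witness ∉ A m
      index<remaining : ∀ {m} → remaining m → index < m

  choose : (s : Stage) → Choice s
  choose s with infinite-homogeneous-subset _∈A_ (Stage.used s) (Stage.infinite s)
  ... | Q , infQ , Q⊆candidates , homQ with infQ 0
  ... | c , _ , Qc with private-element infQ homQ Qc
  ... | x , x∈Ac , x∉used , infx = record
    { index = c
    ; witness = x
    ; remaining = (Q ∩ λ m → x ∉ A m) ∩ (c <_)
    ; remaining-infinite = infinite-∩-eventually infx (eventually-above c)
    ; remaining⊆candidates = Q⊆candidates ∘ proj₁ ∘ proj₁
    ; index∈candidates = Q⊆candidates Qc
    ; witness∈index = x∈Ac
    ; witness∉used = x∉used
    ; witness∉remaining = proj₂ ∘ proj₁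
    ; index<remaining = proj₂
    }

  next : Stage → Stage
  next s = record
    { candidates = Choice.remaining c
    ; infinite = Choice.remaining-infinite c
    ; used = A (Choice.index c) ++ Stage.used s
    }
    where c = choose s

  stage : ℕ → Stage
  stage zero = record { candidates = λ _ → ⊤ ; infinite = λ n → n , ≤-refl , tt ; used = [] }
  stage (suc i) = next (stage i)

  chosen : (i : ℕ) → Choice (stage i)
  chosen i = choose (stage i)

  g k : ℕ → ℕ
  g i = Choice.index (chosen i)
  k i = Choice.witness (chosen i)

  candidates-antitone : ∀ {i j} → i ≤′ j → Stage.candidates (stage j) ⊆ Stage.candidates (stage i)
  candidates-antitone ≤′-refl = id
  candidates-antitone (≤′-step {j} i≤j) =
    candidates-antitone i≤j ∘ Choice.remaining⊆candidates (chosen j)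

  used-monotone : ∀ {i j} → i ≤′ j → Stage.used (stage i) ⊆ˢ Stage.used (stage j)
  used-monotone ≤′-refl = id
  used-monotone (≤′-step {j} i≤j) = ∈-++⁺ʳ (A (g j)) ∘ used-monotone i≤j

  later-index-remains : ∀ {i j} → i < j → Choice.remaining (chosen i) (g j)
  later-index-remains {j = j} i<j = candidates-antitone (≤⇒≤′ i<j) (Choice.index∈candidates (chosen j))

  earlier-set-used : ∀ {i j} → j < i → A (g j) ⊆ˢ Stage.used (stage i)
  earlier-set-used j<i = used-monotone (≤⇒≤′ j<i) ∘ ∈-++⁺ˡ

  g-injective : ∀ {i j} → i ≢ j → g i ≢ g j
  g-injective {i} {j} i≢j with <-cmp i j
  ... | tri< i<j _ _ = λ gi≡gj →
    <-irrefl gi≡gj (Choice.index<remaining (chosen i) (later-index-remains i<j))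
  ... | tri≈ _ i≡j _ = ⊥-elim (i≢j i≡j)
  ... | tri> _ _ j<i = λ gi≡gj →
    <-irrefl (sym gi≡gj) (Choice.index<remaining (chosen j) (later-index-remains j<i))

  chosen-sets-distinct : ∀ i j → i ≢ j → ¬ (A (g i) ≐ A (g j))
  chosen-sets-distinct i j i≢j (gi⊆gj , _) = anti (g i) (g j) (g-injective i≢j) gi⊆gj

  k-private : ∀ i j → j ≢ i → k i ∉ A (g j)
  k-private i j j≢i with <-cmp j i
  ... | tri< j<i _ _ = Choice.witness∉used (chosen i) ∘ earlier-set-used j<i
  ... | tri≈ _ j≡i _ = ⊥-elim (j≢i j≡i)
  ... | tri> _ _ i<j = Choice.witness∉remaining (chosen i) (later-index-remains i<j)

mainTheorem4 : ExcludedMiddle 0ℓ →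
    (A : ℕ → FinSubset) → IsAntichain A →
    Σ[ g ∈ (ℕ → ℕ) ] Σ[ k ∈ (ℕ → ℕ) ]
      ((∀ i j → i ≢ j → ¬ (A (g i) ≐ A (g j))) ×
       (∀ i → (k i ∈ A (g i)) × (∀ j → j ≢ i → k i ∉ A (g j))))
mainTheorem4 em A anti =
  g , k , chosen-sets-distinct , λ i → Choice.witness∈index (chosen i) , k-private i
  where open Construction em A anti
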